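{- Let $G$ be a finite graph and $AB$ an edge of $G$ such that $B$ is a leaf (has degree $1$). If the sages lose the hat guessing game (without hints) on the graph $G\setminus\{B\}$, then they also lose it on $G$.
   Context: Hat guessing game: a sage sits at each vertex of a finite graph; hat colors are $H=\{0,1,2\}$; each sage sees only his neighbours' hats and guesses his own color by a deterministic function of the neighbours' colors, fixed in advance. A strategy is winning if for every hat placement at least one sage guesses correctly; the sages lose if no winning strategy exists. -}

module Defs where

open import Data.Nat using (ℕ; suc)
open import Data.Fin using (Fin; punchIn)
open import Data.Bool using (Bool; true; false)
open import Data.Product using (Σ; ∃; _×_; _,_)
open import Relation.Binary.PropositionalEquality using (_≡_)
open import Relation.Nullary using (¬_)

Hat : Set
Hat = Fin 3

record Graph (n : ℕ) : Set where
  field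
    adj   : Fin n → Fin n → Bool
    sym   : ∀ u v → adj u v ≡ adj v u
    irref : ∀ v → adj v v ≡ false
open Graph public

Placement : ℕ → Set
Placement n = Fin n → Hat

AgreeOnNbrs : ∀ {n} → Graph n → Fin n → Placement n → Placement n → Set
AgreeOnNbrs G v c c' = ∀ u → adj G v u ≡ true → c u ≡ c' u

record Strategy {n : ℕ} (G : Graph n) : Set where
  field
    guess : Fin n → Placement n → Hat
    local : ∀ v c c' → AgreeOnNbrs G v c c' → guess v c ≡ guess v c'
open Strategy public

Winning : ∀ {n} {G : Graph n} → Strategy G → Set
Winning {n} S = ∀ (c : Placement n) → ∃ λ v → guess S v c ≡ c v

SagesLose : ∀ {n} → Graph n → Set
SagesLose G = ¬ (Σ (Strategy G) Winning)

degree-one : ∀ {n} → Graph n → Fin n → Fin n → Set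
degree-one G B A = adj G B A ≡ true × (∀ u → adj G B u ≡ true → u ≡ A)

-- Induced subgraph G ∖ {B}, with vertices Fin n embedded via punchIn B.
deleteVertex : ∀ {n} → Graph (suc n) → Fin (suc n) → Graph n
deleteVertex G B = record
  { adj   = λ u v → adj G (punchIn B u) (punchIn B v)
  ; sym   = λ u v → sym G (punchIn B u) (punchIn B v)
  ; irref = λ v → irref G (punchIn B v)
  }

-- If the sages win on G, they win on G ∖ {B}: the neighbour A of the leaf B
-- guesses the majority of the guesses it would make in G for the three
-- possible hats of B, and everybody else plays as in G.  B's guess f in G
-- does not depend on B's own hat, so for each of the two hats b ≢ f some
-- sage other than B is right.  Sages other than A do not see B, so if one of
-- them is right he is right in G ∖ {B} too; otherwise A is right for both
-- b ≢ f, hence his majority vote is right.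
module Submission where

open import Defs hiding (sym)
open import Function using (_∘_)
open import Data.Nat using (ℕ; suc)
open import Data.Fin using (Fin; zero; suc; punchIn; punchOut; _≟_)
open import Data.Fin.Properties using (any?; punchIn-injective; punchIn-punchOut)
open import Data.Vec.Functional using (insertAt)
open import Data.Vec.Functional.Properties using (insertAt-lookup; insertAt-punchIn)
open import Data.Bool using (true)
open import Data.Product using (∃; _,_; proj₁; proj₂)
open import Data.Empty using (⊥-elim)
open import Relation.Binary.PropositionalEquality
  using (_≡_; _≢_; refl; sym; trans; subst; module ≡-Reasoning)
open import Relation.Nullary using (yes; no)

majority₃ : Hat → Hat → Hat → Hat
majority₃ x y z with x ≟ y
... | yes _ = x
... | no _  = z

majority : (Hat → Hat) → Hat
majority h = majority₃ (h zero) (h (suc zero)) (h (suc (suc zero)))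

majority-cong : ∀ {h k : Hat → Hat} → (∀ b → h b ≡ k b) → majority h ≡ majority k
majority-cong {h} {k} h≗k
  rewrite h≗k zero | h≗k (suc zero) | h≗k (suc (suc zero)) = refl

majority-≡ : ∀ (h : Hat → Hat) {x} f → (∀ b → b ≢ f → h b ≡ x) → majority h ≡ x
majority-≡ h f agree with h zero ≟ h (suc zero)
majority-≡ h zero             agree | yes h0≡h1 = trans h0≡h1 (agree (suc zero) λ ())
majority-≡ h (suc zero)       agree | yes _     = agree zero λ ()
majority-≡ h (suc (suc zero)) agree | yes _     = agree zero λ ()
majority-≡ h zero             agree | no _      = agree (suc (suc zero)) λ ()
majority-≡ h (suc zero)       agree | no _      = agree (suc (suc zero)) λ ()
majority-≡ h (suc (suc zero)) agree | no h0≢h1  =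
  ⊥-elim (h0≢h1 (trans (agree zero λ ()) (sym (agree (suc zero) λ ()))))

data PunchInView {n} (i : Fin (suc n)) : Fin (suc n) → Set where
  at-i      : PunchInView i i
  punchedIn : ∀ j → PunchInView i (punchIn i j)

punchInView : ∀ {n} (i j : Fin (suc n)) → PunchInView i j
punchInView i j with i ≟ j
... | yes refl = at-i
... | no i≢j   = subst (PunchInView i) (punchIn-punchOut i≢j) (punchedIn _)

insertAt-≢ : ∀ {n} {A : Set} (xs : Fin n → A) i {v w j} →
  j ≢ i → insertAt xs i v j ≡ insertAt xs i w j
insertAt-≢ xs i {v} {w} {j} j≢i with punchInView i j
... | at-i         = ⊥-elim (j≢i refl)
... | punchedIn j' = trans (insertAt-punchIn xs i v j') (sym (insertAt-punchIn xs i w j'))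

module _ {n} (G : Graph n) where

  adj⇒≢ : ∀ {u v} → adj G u v ≡ true → v ≢ u
  adj⇒≢ {u} uv refl with trans (sym uv) (irref G u)
  ... | ()

  guess-ignores-own-hat : ∀ (S : Strategy G) v {c c'} →
    (∀ u → u ≢ v → c u ≡ c' u) → guess S v c ≡ guess S v c'
  guess-ignores-own-hat S v agree = local S v _ _ λ u vu → agree u (adj⇒≢ vu)

insertAt-agree : ∀ {n} (G : Graph (suc n)) B u {c c' : Placement n} {b b'} →
  AgreeOnNbrs (deleteVertex G B) u c c' →
  (adj G (punchIn B u) B ≡ true → b ≡ b') →
  AgreeOnNbrs G (punchIn B u) (insertAt c B b) (insertAt c' B b')
insertAt-agree G B u {c} {c'} {b} {b'} agree sees-B w uw with punchInView B w
... | at-i = begin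
  insertAt c B b B    ≡⟨ insertAt-lookup c B b ⟩
  b                   ≡⟨ sees-B uw ⟩
  b'                  ≡⟨ insertAt-lookup c' B b' ⟨
  insertAt c' B b' B  ∎
  where open ≡-Reasoning
... | punchedIn w' = begin
  insertAt c B b (punchIn B w')    ≡⟨ insertAt-punchIn c B b w' ⟩
  c w'                             ≡⟨ agree w' uw ⟩
  c' w'                            ≡⟨ insertAt-punchIn c' B b' w' ⟨
  insertAt c' B b' (punchIn B w')  ∎
  where open ≡-Reasoning

module LeafDeletion {n} (G : Graph (suc n)) (A B : Fin (suc n))
                    (leaf : degree-one G B A) (S : Strategy G) where

  guessWith : Fin n → Placement n → Hat → Hat
  guessWith u c b = guess S (punchIn B u) (insertAt c B b)

  restrict : Strategy (deleteVertex G B)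
  restrict = record
    { guess = λ u c → majority (guessWith u c)
    ; local = λ u c c' agree →
        majority-cong λ b → local S _ _ _ (insertAt-agree G B u {b = b} agree λ _ → refl)
    }

  guessWith-constant : ∀ {u} → punchIn B u ≢ A → ∀ c b b' → guessWith u c b ≡ guessWith u c b'
  guessWith-constant {u} u≢A c b b' = local S _ _ _ (insertAt-agree G B u (λ _ _ → refl) sees-B)
    where
    sees-B : adj G (punchIn B u) B ≡ true → b ≡ b'
    sees-B uB = ⊥-elim (u≢A (proj₂ leaf _ (trans (Graph.sym G B (punchIn B u)) uB)))

  guessOfB : Placement n → Hat
  guessOfB c = guess S B (insertAt c B zero)

  winner-other-than-B : Winning S → ∀ c b → b ≢ guessOfB c → ∃ λ u → guessWith u c b ≡ c u
  winner-other-than-B W c b b≢f with W (insertAt c B b)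
  ... | v , correct with punchInView B v
  ...   | at-i = ⊥-elim (b≢f (begin
    b                          ≡⟨ insertAt-lookup c B b ⟨
    insertAt c B b B           ≡⟨ correct ⟨
    guess S B (insertAt c B b) ≡⟨ guess-ignores-own-hat G S B (λ _ → insertAt-≢ c B) ⟩
    guessOfB c                 ∎))
    where open ≡-Reasoning
  ...   | punchedIn u = u , trans correct (insertAt-punchIn c B b u)

  A≢B : A ≢ B
  A≢B = adj⇒≢ G (proj₁ leaf)

  uA : Fin n
  uA = punchOut (A≢B ∘ sym)

  restrict-winning : Winning S → Winning restrict
  restrict-winning W c with any? (λ u → majority (guessWith u c) ≟ c u)
  ... | yes winner = winner
  ... | no noWinner = uA , majority-≡ (guessWith uA c) (guessOfB c) A-correct
    where
    A-correct : ∀ b → b ≢ guessOfB c → guessWith uA c b ≡ c uA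
    A-correct b b≢f with winner-other-than-B W c b b≢f
    ... | u , correct with punchIn B u ≟ A
    ...   | yes u≡A with punchIn-injective B u uA (trans u≡A (sym (punchIn-punchOut _)))
    ...     | refl = correct
    A-correct b b≢f | u , correct | no u≢A = ⊥-elim (noWinner (u ,
      majority-≡ (guessWith u c) b λ b' _ → trans (guessWith-constant u≢A c b' b) correct))

corollary1 : (n : ℕ) (G : Graph (suc n)) (A B : Fin (suc n)) →
    degree-one G B A → SagesLose (deleteVertex G B) → SagesLose G
corollary1 n G A B leaf lose (S , W) = lose (restrict , restrict-winning W)
  where open LeafDeletion G A B leaf S
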